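{- Let $P_n$ be the path on $n\ge 4$ vertices. Then $\tau(P_n)=\frac{7n-6}{3n}$ if $n=3t$ for some $t\in\mathbb{N}$; $\tau(P_n)=\frac{7n-5}{3n}$ if $n=3t-1$ for some $t\in\mathbb{N}$; and $\tau(P_n)=\frac{7n-4}{3n}$ if $n=3t-2$ for some $t\in\mathbb{N}$.
   Context: A vertex colouring $\varphi$ of a graph $G$ is a Thue colouring if there is no integer $m\ge 1$ and no path $v_1\cdots v_{2m}$ in $G$ (distinct vertices, consecutive ones adjacent) with $\varphi(v_i)=\varphi(v_{i+m})$ for all $1\le i\le m$. The Thue chromatic number $\pi(G)$ is the minimum number of colours in a Thue colouring of $G$ (for disconnected $G$, the maximum over components). For a graph $G$ with $\epsilon$ edges, an edge deletion sequence is an ordering $(f_1,\dots,f_\epsilon)$ of $E(G)$; it defines $G^*_0=G$ and $G^*_i=G^*_{i-1}-f_i$ (vertices are kept), and its $\tau$-value is $\frac{1}{\epsilon+1}\sum_{i=0}^{\epsilon}\pi(G^*_i)$. The $\tau$-index $\tau(G)$ is the minimum of the $\tau$-values over all edge deletion sequences of $G$. -}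

module Defs where

open import Data.Nat using (ℕ; zero; suc; _+_; _*_; _≤_)
open import Data.Fin using (Fin; toℕ; _↑ˡ_; _↑ʳ_; inject₁)
open import Data.Product using (Σ; ∃-syntax; _×_; _,_)
open import Data.Sum using (_⊎_)
open import Data.List using (tabulate)
open import Data.Nat.ListAction using (sum)
open import Data.Integer using (+_)
open import Data.Rational using (ℚ; 0ℚ; _/_) renaming (_≤_ to _≤ℚ_)
open import Data.Fin.Permutation using (Permutation′; _⟨$⟩ʳ_)
open import Function.Definitions using (Injective)
open import Relation.Binary.PropositionalEquality using (_≡_)
open import Relation.Nullary using (¬_)

-- A (multi)graph on vertex set Fin n given by an indexed family of edges.
record Graph : Set where
  field
    n     : ℕ
    ε     : ℕ
    ends  : Fin ε → Fin n × Fin n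

open Graph public

Rel : ℕ → Set₁
Rel n = Fin n → Fin n → Set

Joins : ∀ {n} → Fin n × Fin n → Fin n → Fin n → Set
Joins (a , b) u v = (a ≡ u × b ≡ v) ⊎ (a ≡ v × b ≡ u)

IsPath : ∀ {n} → Rel n → (k : ℕ) → (Fin k → Fin n) → Set
IsPath Adj k v = Injective _≡_ _≡_ v ×
  (∀ (i j : Fin k) → toℕ j ≡ suc (toℕ i) → Adj (v i) (v j))

IsThueColouring : ∀ {n} → Rel n → (k : ℕ) → (Fin n → Fin k) → Set
IsThueColouring {n} Adj k φ =
  ∀ (m : ℕ) → 1 ≤ m → (v : Fin (m + m) → Fin n) → IsPath Adj (m + m) v →
    ¬ (∀ (i : Fin m) → φ (v (i ↑ˡ m)) ≡ φ (v (m ↑ʳ i)))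

HasThueNumber : ∀ {n} → Rel n → ℕ → Set
HasThueNumber {n} Adj k =
  (Σ (Fin n → Fin k) (IsThueColouring Adj k)) ×
  (∀ (j : ℕ) (ψ : Fin n → Fin j) → IsThueColouring Adj j ψ → k ≤ j)

-- G*_i for the edge deletion sequence f_{j+1} = ends (σ j) (j 0-based):
-- the edges f_1..f_i are removed, i.e. keep positions j with i ≤ toℕ j.
GStar : (G : Graph) → Permutation′ (ε G) → ℕ → Rel (n G)
GStar G σ i u v = ∃[ j ] (i ≤ toℕ j × Joins (ends G (σ ⟨$⟩ʳ j)) u v)

-- a / d as a rational (d = 0 never used)
frac : ℕ → ℕ → ℚ
frac a zero    = 0ℚ
frac a (suc d) = (+ a) / suc d

-- τ-value of the deletion sequence σ, given that p i = π(G*_i)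
TauValue : (G : Graph) → Permutation′ (ε G) → (Fin (suc (ε G)) → ℕ) → ℚ
TauValue G σ p = frac (sum (tabulate p)) (suc (ε G))

ValidPis : (G : Graph) → Permutation′ (ε G) → (Fin (suc (ε G)) → ℕ) → Set
ValidPis G σ p = ∀ (i : Fin (suc (ε G))) → HasThueNumber (GStar G σ (toℕ i)) (p i)

IsTauIndex : Graph → ℚ → Set
IsTauIndex G q =
  (∃[ σ ] ∃[ p ] (ValidPis G σ p × TauValue G σ p ≡ q)) ×
  (∀ σ p → ValidPis G σ p → q ≤ℚ TauValue G σ p)

P : ℕ → Graph
P zero    = record { n = zero ; ε = zero ; ends = λ () }
P (suc m) = record { n = suc m ; ε = m ; ends = λ k → (inject₁ k , Fin.suc k) }
  where import Data.Fin as Fin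

module Submission where

-- τ-index of paths.  We prove τ(P (m+1)) = (2m + 1 + ⌊m/3⌋)/(m+1) for every m
-- (tau-path); the three closed forms of the proposition are this value for m = 3t + r.
--
-- Group the m edges {e, e+1} of P (m+1) into k = ⌊m/3⌋ blocks {3a, 3a+1, 3a+2}.
-- Lower bound, for every deletion sequence: while fewer than k edges are deleted some
-- block is intact (pigeonhole), and a path on four vertices needs three colours; while
-- an edge remains two colours are needed; one colour is always needed.
-- Upper bound: delete first the k edges 3a+2, then the others.  Any subgraph of a path
-- is Thue-coloured with three colours by the square-free word of consecutive pairs of
-- the Thue–Morse word t (which is overlap-free by Thue's theorem); once the edges 3a+2
-- are gone, the colouring 0,1,0 of every block is a Thue colouring; an edgeless graph
-- needs one colour.  Summing the profile 3, …, 3, 2, …, 2, 1 gives the value.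

open import Defs
open import Data.Nat
open import Data.Nat.Properties
open import Data.Nat.Induction using (<-wellFounded)
open import Data.Nat.Tactic.RingSolver using (solve-∀)
open import Data.Nat.ListAction using (sum)
open import Data.Bool using (Bool; true; false; not)
open import Data.Bool.Properties using (not-injective; not-¬; ¬-not) renaming (_≟_ to _≟ᵇ_)
open import Data.Fin using (Fin; toℕ; fromℕ<; inject₁; inject≤; _↑ˡ_; _↑ʳ_)
  renaming (zero to fzero; suc to fsuc)
open import Data.Fin.Properties
  using (toℕ-injective; toℕ-↑ˡ; toℕ-↑ʳ; toℕ-fromℕ<; toℕ<n; toℕ-inject≤; toℕ-inject₁;
         any?; all?; ¬∀⟶∃¬; pigeonhole)
  renaming (suc-injective to fsuc-injective)
open import Data.Fin.Permutation using (Permutation′; permutation; _⟨$⟩ʳ_; _⟨$⟩ˡ_; inverseʳ)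
open import Data.List using (tabulate)
open import Data.Product using (Σ; _×_; _,_; ∃-syntax; proj₁; proj₂)
open import Data.Sum using (_⊎_; inj₁; inj₂)
open import Data.Empty using (⊥; ⊥-elim)
open import Function using (_∘_)
open import Function.Definitions using (Injective)
open import Induction.WellFounded using (Acc; acc)
open import Relation.Nullary using (¬_; yes; no; contradiction)
open import Relation.Binary.PropositionalEquality
import Data.Integer as ℤ
import Data.Integer.Properties as ℤ
open import Data.Rational using () renaming (_≤_ to _≤ℚ_)
import Data.Rational.Properties as ℚ
import Data.Rational.Unnormalised as ℚᵘ
import Data.Rational.Unnormalised.Properties as ℚᵘ

double : ℕ → ℕ
double zero    = zero
double (suc k) = suc (suc (double k))

double-+ : ∀ x y → double (x + y) ≡ double x + double y
double-+ zero    y = refl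
double-+ (suc x) y = cong (λ z → suc (suc z)) (double-+ x y)

k≤double : ∀ k → k ≤ double k
k≤double zero    = z≤n
k≤double (suc k) = s≤s (m≤n⇒m≤1+n (k≤double k))

data EvenOdd : ℕ → Set where
  even : ∀ k → EvenOdd (double k)
  odd  : ∀ k → EvenOdd (suc (double k))

evenOdd : ∀ n → EvenOdd n
evenOdd zero = even zero
evenOdd (suc n) with evenOdd n
... | even k = odd k
... | odd k  = even (suc k)

evenOdd-even : ∀ k → evenOdd (double k) ≡ even k
evenOdd-even zero = refl
evenOdd-even (suc k) rewrite evenOdd-even k = refl

evenOdd-odd : ∀ k → evenOdd (suc (double k)) ≡ odd k
evenOdd-odd k rewrite evenOdd-even k = refl

-- The Thue–Morse word t : ℕ → Bool, t 0 = false, t (2k) = t k, t (2k+1) = not (t k),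
-- computed with a fuel bound f ≥ n.  The word is kept abstract: only tm-double and
-- tm-odd are used afterwards.
tmFuel : ℕ → ℕ → Bool
tmFuel zero    n = false
tmFuel (suc f) n with evenOdd n
... | even k = tmFuel f k
... | odd k  = not (tmFuel f k)

tmFuel-zero : ∀ f → tmFuel f 0 ≡ false
tmFuel-zero zero    = refl
tmFuel-zero (suc f) = tmFuel-zero f

double≤suc⇒≤ : ∀ k f → double k ≤ suc f → k ≤ f
double≤suc⇒≤ zero    f _               = z≤n
double≤suc⇒≤ (suc k) f (s≤s 1+2k≤f) = ≤-trans (s≤s (k≤double k)) 1+2k≤f

tmFuel-stable : ∀ f g n → n ≤ f → n ≤ g → tmFuel f n ≡ tmFuel g n
tmFuel-stable zero    g       zero    _ _ = sym (tmFuel-zero g)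
tmFuel-stable (suc f) zero    zero    _ _ = tmFuel-zero (suc f)
tmFuel-stable (suc f) (suc g) n       n≤f n≤g with evenOdd n
... | even k = tmFuel-stable f g k (double≤suc⇒≤ k f n≤f) (double≤suc⇒≤ k g n≤g)
... | odd k  = cong not (tmFuel-stable f g k (≤-trans (k≤double k) (≤-pred n≤f))
                                             (≤-trans (k≤double k) (≤-pred n≤g)))

abstract
  tm : ℕ → Bool
  tm n = tmFuel n n

  tm-double : ∀ k → tm (double k) ≡ tm k
  tm-double k = begin
    tmFuel (double k) (double k)        ≡⟨ tmFuel-stable _ _ (double k) ≤-refl (n≤1+n _) ⟩
    tmFuel (suc (double k)) (double k)  ≡⟨ unfold ⟩
    tmFuel (double k) k                 ≡⟨ tmFuel-stable _ _ k (k≤double k) ≤-refl ⟩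
    tmFuel k k                          ∎
    where
      open ≡-Reasoning
      unfold : tmFuel (suc (double k)) (double k) ≡ tmFuel (double k) k
      unfold rewrite evenOdd-even k = refl

  tm-odd : ∀ k → tm (suc (double k)) ≡ not (tm k)
  tm-odd k = begin
    tmFuel (suc (double k)) (suc (double k))  ≡⟨ unfold ⟩
    not (tmFuel (double k) k)                 ≡⟨ cong not (tmFuel-stable _ _ k (k≤double k) ≤-refl) ⟩
    not (tmFuel k k)                          ∎
    where
      open ≡-Reasoning
      unfold : tmFuel (suc (double k)) (suc (double k)) ≡ not (tmFuel (double k) k)
      unfold rewrite evenOdd-odd k = refl

tm-block : ∀ k → tm (double k) ≢ tm (suc (double k))
tm-block k eq = not-¬ refl (trans (sym (tm-double k)) (trans eq (tm-odd k)))

no-triple : ∀ q → tm q ≡ tm (suc q) → tm (suc q) ≢ tm (suc (suc q))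
no-triple q with evenOdd q
... | even k = λ e _ → tm-block k e
... | odd k  = λ _ e → tm-block (suc k) e

boundary-change : ∀ k → tm (suc (double k)) ≢ tm (double (suc k)) → tm k ≡ tm (suc k)
boundary-change k change =
  not-injective (¬-not (λ e → change (trans (tm-odd k) (trans e (sym (tm-double (suc k)))))))

-- A factor of length 4 of t cannot occur both at an even and at an odd position:
-- its two blocks change inside, so at the odd position t changes at two consecutive
-- block boundaries, giving three equal letters t k, t (k+1), t (k+2).
factor4-parity : ∀ x k → (∀ i → i ≤ 3 → tm (i + double x) ≡ tm (i + suc (double k))) → ⊥
factor4-parity x k same = no-triple k (boundary-change k change₁) (boundary-change (suc k) change₂)
  where
    change₁ : tm (suc (double k)) ≢ tm (double (suc k))
    change₁ e = tm-block x (trans (same 0 z≤n) (trans e (sym (same 1 (s≤s z≤n)))))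
    change₂ : tm (suc (double (suc k))) ≢ tm (double (suc (suc k)))
    change₂ e = tm-block (suc x) (trans (same 2 (s≤s (s≤s z≤n))) (trans e (sym (same 3 ≤-refl))))

-- An overlap of period m at p: t (i+p) = t (i+m+p) for all i ≤ m, i.e. a factor axaxa with |ax| = m.
Overlap : ℕ → ℕ → Set
Overlap p m = ∀ i → i ≤ m → tm (i + p) ≡ tm (i + (m + p))

double-mono : ∀ {x y} → x ≤ y → double x ≤ double y
double-mono z≤n       = z≤n
double-mono (s≤s x≤y) = s≤s (s≤s (double-mono x≤y))

double-+-suc : ∀ x y → double x + suc (double y) ≡ suc (double (x + y))
double-+-suc x y = trans (+-suc (double x) (double y)) (cong suc (sym (double-+ x y)))

overlap-halve-even : ∀ a m → Overlap (double a) (double m) → Overlap a m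
overlap-halve-even a m O i i≤m = begin
  tm (i + a)                             ≡⟨ sym (tm-double (i + a)) ⟩
  tm (double (i + a))                    ≡⟨ cong tm (double-+ i a) ⟩
  tm (double i + double a)               ≡⟨ O (double i) (double-mono i≤m) ⟩
  tm (double i + (double m + double a))  ≡⟨ cong (λ z → tm (double i + z)) (sym (double-+ m a)) ⟩
  tm (double i + double (m + a))         ≡⟨ cong tm (sym (double-+ i (m + a))) ⟩
  tm (double (i + (m + a)))              ≡⟨ tm-double (i + (m + a)) ⟩
  tm (i + (m + a))                       ∎
  where open ≡-Reasoning

overlap-halve-odd : ∀ a m → Overlap (suc (double a)) (double m) → Overlap a m
overlap-halve-odd a m O i i≤m = not-injective (begin
  not (tm (i + a))                             ≡⟨ sym (tm-odd (i + a)) ⟩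
  tm (suc (double (i + a)))                    ≡⟨ cong tm (sym (double-+-suc i a)) ⟩
  tm (double i + suc (double a))               ≡⟨ O (double i) (double-mono i≤m) ⟩
  tm (double i + (double m + suc (double a)))  ≡⟨ cong (λ z → tm (double i + z)) (double-+-suc m a) ⟩
  tm (double i + suc (double (m + a)))         ≡⟨ cong tm (double-+-suc i (m + a)) ⟩
  tm (suc (double (i + (m + a))))              ≡⟨ tm-odd (i + (m + a)) ⟩
  not (tm (i + (m + a)))                       ∎)
  where open ≡-Reasoning

no-overlap-1 : ∀ p → ¬ Overlap p 1
no-overlap-1 p O = no-triple p (O 0 z≤n) (O 1 ≤-refl)

3≤odd-period : ∀ M → 3 ≤ suc (double (suc M))
3≤odd-period M = s≤s (s≤s (s≤s z≤n))

-- An overlap of odd period ≥ 3 contains a factor of length 4 at positions of both parities.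
no-overlap-odd : ∀ p M → ¬ Overlap p (suc (double (suc M)))
no-overlap-odd p M O with evenOdd p
... | even a = factor4-parity a (suc M + a) λ i i≤3 →
        trans (O i (≤-trans i≤3 (3≤odd-period M))) (cong (λ z → tm (i + suc z)) (sym (double-+ (suc M) a)))
... | odd a = factor4-parity (suc (suc M + a)) a λ i i≤3 →
        sym (trans (O i (≤-trans i≤3 (3≤odd-period M))) (cong (λ z → tm (i + suc z)) (double-+-suc (suc M) a)))

half<double : ∀ M → suc M < double (suc M)
half<double M = s≤s (s≤s (k≤double M))

overlap-free : ∀ m p → 1 ≤ m → ¬ Overlap p m
overlap-free m = go m (<-wellFounded m)
  where
    go : ∀ m → Acc _<_ m → ∀ p → 1 ≤ m → ¬ Overlap p m
    go m (acc smaller) p 1≤m O with evenOdd m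
    go .0 _ p () O | even zero
    ... | even (suc M) with evenOdd p
    ...   | even a = go (suc M) (smaller (half<double M)) a (s≤s z≤n) (overlap-halve-even a (suc M) O)
    ...   | odd a  = go (suc M) (smaller (half<double M)) a (s≤s z≤n) (overlap-halve-odd a (suc M) O)
    go m _ p 1≤m O | odd zero    = no-overlap-1 p O
    go m _ p 1≤m O | odd (suc M) = no-overlap-odd p M O

-- The square-free ternary word: the letter at n encodes the pair (t n , t (n+1)),
-- identifying the two constant pairs.
letter : Bool → Bool → Fin 3
letter false false = fsuc fzero
letter true  true  = fsuc fzero
letter false true  = fsuc (fsuc fzero)
letter true  false = fzero

ternaryTM : ℕ → Fin 3
ternaryTM n = letter (tm n) (tm (suc n))

letter-next : ∀ {x x' y y'} → x ≡ x' → letter x y ≡ letter x' y' → y ≡ y'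
letter-next {false} {y = false} {false} refl _ = refl
letter-next {false} {y = true}  {true}  refl _ = refl
letter-next {true}  {y = false} {false} refl _ = refl
letter-next {true}  {y = true}  {true}  refl _ = refl
letter-next {false} {y = false} {true}  refl ()
letter-next {false} {y = true}  {false} refl ()
letter-next {true}  {y = false} {true}  refl ()
letter-next {true}  {y = true}  {false} refl ()

letter-flip : ∀ {x x' y y'} → x ≢ x' → letter x y ≡ letter x' y' → y ≡ x × y' ≡ x'
letter-flip {false} {true}  {false} {true}  _ _  = refl , refl
letter-flip {true}  {false} {true}  {false} _ _  = refl , refl
letter-flip {false} {false} x≢x' _ = ⊥-elim (x≢x' refl)
letter-flip {true}  {true}  x≢x' _ = ⊥-elim (x≢x' refl)
letter-flip {false} {true}  {false} {false} _ ()
letter-flip {false} {true}  {true}  {false} _ ()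
letter-flip {false} {true}  {true}  {true}  _ ()
letter-flip {true}  {false} {false} {false} _ ()
letter-flip {true}  {false} {false} {true}  _ ()
letter-flip {true}  {false} {true}  {true}  _ ()

Square : ∀ {A : Set} → (ℕ → A) → ℕ → ℕ → Set
Square w p m = ∀ i → i < m → w (i + p) ≡ w (i + (m + p))

square⇒overlap : ∀ p m → Square ternaryTM p m → tm p ≡ tm (m + p) → Overlap p m
square⇒overlap p m sq same zero    _   = same
square⇒overlap p m sq same (suc i) i<m =
  letter-next (square⇒overlap p m sq same i (≤-trans (n≤1+n i) i<m)) (sq i i<m)

square⇒constant : ∀ p m → Square ternaryTM p m → tm p ≢ tm (m + p) →
  ∀ i → i ≤ m → tm (i + p) ≡ tm p × tm (i + (m + p)) ≡ tm (m + p)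
square⇒constant p m sq differ zero    _   = refl , refl
square⇒constant p m sq differ (suc i) i<m
  with square⇒constant p m sq differ i (≤-trans (n≤1+n i) i<m)
... | left , right with letter-flip (λ e → differ (trans (sym left) (trans e right))) (sq i i<m)
...   | left′ , right′ = trans left′ left , trans right′ right

ternaryTM-squarefree : ∀ p m → 1 ≤ m → ¬ Square ternaryTM p m
ternaryTM-squarefree p m 1≤m sq with tm p ≟ᵇ tm (m + p)
... | yes same  = overlap-free m p 1≤m (square⇒overlap p m sq same)
... | no differ = differ (sym (proj₁ (square⇒constant p m sq differ m ≤-refl)))

UnitSteps : ∀ {L} → (Fin L → ℕ) → Set
UnitSteps f = ∀ i j → toℕ j ≡ suc (toℕ i) → suc (f i) ≡ f j ⊎ suc (f j) ≡ f i

-- An injective sequence with unit steps cannot turn back, so it is an interval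
-- traversed upwards or downwards.
unitSteps-monotone : ∀ {L} (f : Fin (suc L) → ℕ) → UnitSteps f → Injective _≡_ _≡_ f →
  (∀ x → f x ≡ toℕ x + f fzero) ⊎ (∀ x → toℕ x + f x ≡ f fzero)
unitSteps-monotone {zero} f _ _ = inj₁ λ { fzero → refl }
unitSteps-monotone {suc zero} f steps inj with steps fzero (fsuc fzero) refl
... | inj₁ s = inj₁ λ { fzero → refl ; (fsuc fzero) → sym s }
... | inj₂ s = inj₂ λ { fzero → refl ; (fsuc fzero) → s }
unitSteps-monotone {suc (suc L)} f steps inj
  with unitSteps-monotone (f ∘ fsuc) (λ i j e → steps (fsuc i) (fsuc j) (cong suc e))
                          (λ e → fsuc-injective (inj e))
     | steps fzero (fsuc fzero) refl
... | inj₁ up   | inj₁ s = inj₁ λ { fzero → refl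
                                  ; (fsuc x) → trans (up x) (trans (cong (toℕ x +_) (sym s)) (+-suc _ _)) }
... | inj₂ down | inj₂ s = inj₂ λ { fzero → refl ; (fsuc x) → trans (cong suc (down x)) s }
... | inj₁ up   | inj₂ s = contradiction (inj (trans (up (fsuc fzero)) s)) λ ()
... | inj₂ down | inj₁ s = contradiction (inj (suc-injective (trans (down (fsuc fzero)) (sym s)))) λ ()

-- Graphs on Fin n whose edges join vertices with consecutive numbers (subgraphs of a path).
Consecutive : ∀ {n} → Rel n → Set
Consecutive Adj = ∀ u v → Adj u v → suc (toℕ u) ≡ toℕ v ⊎ suc (toℕ v) ≡ toℕ u

shift-square : ∀ m i b → (m + i) + b ≡ i + (m + b)
shift-square = solve-∀

mirror-right : ∀ m i k q → (m + i) + (k + q) ≡ (m + (k + i)) + q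
mirror-right = solve-∀

mirror-left : ∀ m i k q → i + (k + (m + q)) ≡ (m + (k + i)) + q
mirror-left = solve-∀

colours-nonempty : ∀ {n} j (ψ : Fin (suc n) → Fin j) → 1 ≤ j
colours-nonempty zero    ψ with ψ fzero
... | ()
colours-nonempty (suc j) ψ = s≤s z≤n

pair : ∀ {n} → Fin n → Fin n → Fin 2 → Fin n
pair a b fzero    = a
pair a b (fsuc _) = b

rem3 : ℕ → ℕ
rem3 zero                = 0
rem3 (suc zero)          = 1
rem3 (suc (suc zero))    = 2
rem3 (suc (suc (suc n))) = rem3 n

one-of-three : ∀ b → rem3 b ≢ 2 → rem3 (suc b) ≢ 2 → rem3 (suc (suc b)) ≢ 2 → ⊥
one-of-three zero                _  _  r₂ = r₂ refl
one-of-three (suc zero)          _  r₁ _  = r₁ refl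
one-of-three (suc (suc zero))    r₀ _  _  = r₀ refl
one-of-three (suc (suc (suc b))) = one-of-three b

blockColour : ℕ → Fin 2
blockColour zero                = fzero
blockColour (suc zero)          = fsuc fzero
blockColour (suc (suc zero))    = fzero
blockColour (suc (suc (suc n))) = blockColour n

blockColour-step : ∀ e → rem3 e ≢ 2 → blockColour e ≢ blockColour (suc e)
blockColour-step zero                _  ()
blockColour-step (suc zero)          _  ()
blockColour-step (suc (suc zero))    r₂ _ = r₂ refl
blockColour-step (suc (suc (suc e))) = blockColour-step e

-- Graphs whose edges are {e, e+1} with e ≢ 2 (mod 3): every edge lies inside a block
-- {3a, 3a+1, 3a+2}.
Blocked : ∀ {n} → Rel n → Set
Blocked Adj = ∀ u v → Adj u v →
  (suc (toℕ u) ≡ toℕ v × rem3 (toℕ u) ≢ 2) ⊎ (suc (toℕ v) ≡ toℕ u × rem3 (toℕ v) ≢ 2)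

module _ {n} (Adj : Rel n) where

  path-monotone : ∀ {L} {v : Fin (suc L) → Fin n} → Consecutive Adj →
    IsPath Adj (suc L) v →
    (∀ x → toℕ (v x) ≡ toℕ x + toℕ (v fzero)) ⊎ (∀ x → toℕ x + toℕ (v x) ≡ toℕ (v fzero))
  path-monotone cons (inj , adj) =
    unitSteps-monotone _ (λ i j e → cons _ _ (adj i j e)) (λ e → inj (toℕ-injective e))

  -- Reading ternaryTM along the vertex numbers is a Thue colouring of a Consecutive graph: a
  -- square on an upward path is a square of ternaryTM at its first vertex, and a square
  -- on a downward path is one at its last vertex.
  consecutive-thue : Consecutive Adj → IsThueColouring Adj 3 (ternaryTM ∘ toℕ)
  consecutive-thue cons (suc m′) _ v path sq with path-monotone cons path
  ... | inj₁ up = ternaryTM-squarefree b m (s≤s z≤n) λ i i<m →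
    let I = fromℕ< i<m
        toℕI = toℕ-fromℕ< i<m
    in trans (cong ternaryTM (trans (cong (_+ b) (sym toℕI)) (sym (first I))))
             (trans (sq I) (cong ternaryTM (trans (second I) (cong (_+ (m + b)) toℕI))))
    where
      m = suc m′
      b = toℕ (v fzero)
      first : ∀ (I : Fin m) → toℕ (v (I ↑ˡ m)) ≡ toℕ I + b
      first I = trans (up _) (cong (_+ b) (toℕ-↑ˡ I m))
      second : ∀ (I : Fin m) → toℕ (v (m ↑ʳ I)) ≡ toℕ I + (m + b)
      second I = trans (up _) (trans (cong (_+ b) (toℕ-↑ʳ m I)) (shift-square m (toℕ I) b))
  ... | inj₂ down = ternaryTM-squarefree q m (s≤s z≤n) λ k k<m →
    mirror k (m≤n⇒∃[o]m+o≡n (≤-pred k<m))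
    where
      m = suc m′
      B = toℕ (v fzero)
      at : ∀ x {j} → toℕ x ≡ j → j + toℕ (v x) ≡ B
      at x refl = down x
      last : Fin m
      last = fromℕ< (≤-refl {m})
      q = toℕ (v (m ↑ʳ last))
      q-at : (m + m′) + q ≡ B
      q-at = at (m ↑ʳ last) (trans (toℕ-↑ʳ m last) (cong (m +_) (toℕ-fromℕ< (≤-refl {m}))))
      -- the k-th letters of the two halves, counted from the last vertex, are the
      -- (m′ - k)-th letters counted from the first vertex, in swapped halves
      mirror : ∀ k → ∃[ i ] k + i ≡ m′ → ternaryTM (k + q) ≡ ternaryTM (k + (m + q))
      mirror k (i , k+i≡m′) =
        trans (cong ternaryTM (sym right)) (trans (sym (sq I)) (cong ternaryTM left))
        where
          i<m : i < m
          i<m = s≤s (subst (i ≤_) k+i≡m′ (m≤n+m i k))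
          I = fromℕ< i<m
          toℕI = toℕ-fromℕ< i<m
          B≡ : (m + (k + i)) + q ≡ B
          B≡ = trans (cong (λ z → (m + z) + q) k+i≡m′) q-at
          right : toℕ (v (m ↑ʳ I)) ≡ k + q
          right = +-cancelˡ-≡ (m + i) _ _
            (trans (at (m ↑ʳ I) (trans (toℕ-↑ʳ m I) (cong (m +_) toℕI)))
                   (sym (trans (mirror-right m i k q) B≡)))
          left : toℕ (v (I ↑ˡ m)) ≡ k + (m + q)
          left = +-cancelˡ-≡ i _ _
            (trans (at (I ↑ˡ m) (trans (toℕ-↑ˡ I m) toℕI)) (sym (trans (mirror-left m i k q) B≡)))

  edge-path : ∀ {a b} → Adj a b → a ≢ b → IsPath Adj 2 (pair a b)
  edge-path {a = a} {b} ab a≢b = injective , adjacent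
    where
      injective : Injective _≡_ _≡_ (pair a b)
      injective {fzero}        {fzero}        _ = refl
      injective {fzero}        {fsuc fzero}   e = contradiction e a≢b
      injective {fsuc fzero}   {fzero}        e = contradiction (sym e) a≢b
      injective {fsuc fzero}   {fsuc fzero}   _ = refl
      adjacent : ∀ (i j : Fin 2) → toℕ j ≡ suc (toℕ i) → Adj (pair a b i) (pair a b j)
      adjacent fzero        (fsuc fzero) _ = ab
      adjacent fzero        fzero        ()
      adjacent (fsuc fzero) fzero        ()
      adjacent (fsuc fzero) (fsuc fzero) ()

  -- The ends of an edge get different colours in a Thue colouring (a square of period 1) ...
  thue-edge : ∀ {j ψ a b} → IsThueColouring Adj j ψ → Adj a b → a ≢ b → ψ a ≢ ψ b
  thue-edge thue ab a≢b same = thue 1 ≤-refl _ (edge-path ab a≢b) λ { fzero → same }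

  edge⇒2≤ : ∀ {j ψ a b} → Adj a b → a ≢ b → IsThueColouring Adj j ψ → 2 ≤ j
  edge⇒2≤ {j = zero} {ψ} {a} _ _ _ with ψ a
  ... | ()
  edge⇒2≤ {j = suc zero} {ψ} {a} {b} ab a≢b thue with ψ a in ea | ψ b in eb
  ... | fzero | fzero = contradiction (trans ea (sym eb)) (thue-edge {ψ = ψ} thue ab a≢b)
  edge⇒2≤ {j = suc (suc j)} _ _ _ = s≤s (s≤s z≤n)

  path-edge : ∀ {L v} → IsPath Adj L v →
    ∀ i k → toℕ k ≡ suc (toℕ i) → Adj (v i) (v k) × v i ≢ v k
  path-edge (inj , adj) i k k≡1+i =
    adj i k k≡1+i , λ e → 1+n≢n (sym (trans (cong toℕ (inj e)) k≡1+i))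

  path⇒2≤ : ∀ {L j ψ w} → IsPath Adj (suc (suc L)) w → IsThueColouring Adj j ψ → 2 ≤ j
  path⇒2≤ {ψ = ψ} path thue = edge⇒2≤ {ψ = ψ} (proj₁ first) (proj₂ first) thue
    where first = path-edge path fzero (fsuc fzero) refl

  -- ... and a path on four vertices needs three: two colours would alternate xyxy, a square.
  two-colours-alternate : (x y z : Fin 2) → x ≢ y → y ≢ z → x ≡ z
  two-colours-alternate fzero        fzero        _            x≢y _   = contradiction refl x≢y
  two-colours-alternate fzero        (fsuc fzero) fzero        _   _   = refl
  two-colours-alternate fzero        (fsuc fzero) (fsuc fzero) _   y≢z = contradiction refl y≢z
  two-colours-alternate (fsuc fzero) fzero        fzero        _   y≢z = contradiction refl y≢z
  two-colours-alternate (fsuc fzero) fzero        (fsuc fzero) _   _   = refl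
  two-colours-alternate (fsuc fzero) (fsuc fzero) _            x≢y _   = contradiction refl x≢y

  path4⇒3≤ : ∀ {j ψ w} → IsPath Adj 4 w → IsThueColouring Adj j ψ → 3 ≤ j
  path4⇒3≤ {j = zero} {ψ} path thue with path⇒2≤ {ψ = ψ} path thue
  ... | ()
  path4⇒3≤ {j = suc zero} {ψ} path thue with path⇒2≤ {ψ = ψ} path thue
  ... | s≤s ()
  path4⇒3≤ {j = suc (suc zero)} {ψ} {w} path thue = contradiction alternating (thue 2 (s≤s z≤n) w path)
    where
      change : ∀ i k → toℕ k ≡ suc (toℕ i) → ψ (w i) ≢ ψ (w k)
      change i k k≡1+i = thue-edge {ψ = ψ} thue (proj₁ edge) (proj₂ edge)
        where edge = path-edge path i k k≡1+i
      alternating : ∀ (i : Fin 2) → ψ (w (i ↑ˡ 2)) ≡ ψ (w (2 ↑ʳ i))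
      alternating fzero        = two-colours-alternate _ _ _ (change fzero (fsuc fzero) refl)
                                                             (change (fsuc fzero) (fsuc (fsuc fzero)) refl)
      alternating (fsuc fzero) = two-colours-alternate _ _ _ (change (fsuc fzero) (fsuc (fsuc fzero)) refl)
                                                             (change (fsuc (fsuc fzero)) (fsuc (fsuc (fsuc fzero))) refl)
  path4⇒3≤ {j = suc (suc (suc j))} _ _ = s≤s (s≤s (s≤s z≤n))

  edgeless-thue : (∀ u v → ¬ Adj u v) → IsThueColouring Adj 1 (λ _ → fzero)
  edgeless-thue no-edge (suc m) _ v path _ =
    no-edge _ _ (proj₁ (path-edge path fzero (fromℕ< 1<2m) (toℕ-fromℕ< 1<2m)))
    where
      1<2m : 1 < suc m + suc m
      1<2m = s≤s (≤-trans (s≤s z≤n) (m≤n+m (suc m) m))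

  prefix-path : ∀ {K L v} (K≤L : K ≤ L) → IsPath Adj L v → IsPath Adj K (λ x → v (inject≤ x K≤L))
  prefix-path K≤L (inj , adj) =
    (λ e → toℕ-injective (trans (sym (toℕ-inject≤ _ K≤L)) (trans (cong toℕ (inj e)) (toℕ-inject≤ _ K≤L)))) ,
    (λ i j j≡1+i → adj _ _ (trans (toℕ-inject≤ j K≤L) (trans j≡1+i (cong suc (sym (toℕ-inject≤ i K≤L))))))

  -- A blocked graph has no path on four vertices: the path cannot turn back (that would
  -- revisit a vertex), so it crosses three consecutive edges {e, e+1}, and one of the
  -- three numbers e is ≡ 2 (mod 3).
  blocked-no-path4 : Blocked Adj → ∀ {w} → ¬ IsPath Adj 4 w
  blocked-no-path4 blocked {w} path = cross (step fzero) (step (fsuc fzero)) (step (fsuc (fsuc fzero)))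
    where
      x : Fin 4 → ℕ
      x i = toℕ (w i)
      distinct : ∀ {i k} → x i ≡ x k → i ≡ k
      distinct e = proj₁ path (toℕ-injective e)
      Step : ℕ → ℕ → Set
      Step a b = (suc a ≡ b × rem3 a ≢ 2) ⊎ (suc b ≡ a × rem3 b ≢ 2)
      step : ∀ i → Step (x (inject₁ i)) (x (fsuc i))
      step i = blocked _ _ (proj₁ (path-edge path (inject₁ i) (fsuc i) (cong suc (sym (toℕ-inject₁ i)))))
      cross : Step (x fzero) (x (fsuc fzero)) → Step (x (fsuc fzero)) (x (fsuc (fsuc fzero))) →
              Step (x (fsuc (fsuc fzero))) (x (fsuc (fsuc (fsuc fzero)))) → ⊥
      cross (inj₁ (e₁ , r₁)) (inj₁ (e₂ , r₂)) (inj₁ (_ , r₃)) =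
        one-of-three (x fzero) r₁ (subst (λ z → rem3 z ≢ 2) (sym e₁) r₂)
                                 (subst (λ z → rem3 z ≢ 2) (sym (trans (cong suc e₁) e₂)) r₃)
      cross (inj₂ (_ , r₁)) (inj₂ (e₂ , r₂)) (inj₂ (e₃ , r₃)) =
        one-of-three (x (fsuc (fsuc (fsuc fzero)))) r₃ (subst (λ z → rem3 z ≢ 2) (sym e₃) r₂)
                                                    (subst (λ z → rem3 z ≢ 2) (sym (trans (cong suc e₃) e₂)) r₁)
      cross (inj₁ (e₁ , _)) (inj₂ (e₂ , _)) _ = contradiction (distinct (suc-injective (trans e₁ (sym e₂)))) λ ()
      cross (inj₂ (e₁ , _)) (inj₁ (e₂ , _)) _ = contradiction (distinct (trans (sym e₁) e₂)) λ ()
      cross _ (inj₁ (e₂ , _)) (inj₂ (e₃ , _)) = contradiction (distinct (suc-injective (trans e₂ (sym e₃)))) λ ()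
      cross _ (inj₂ (e₂ , _)) (inj₁ (e₃ , _)) = contradiction (distinct (trans (sym e₂) e₃)) λ ()

  -- The block colouring is a Thue colouring of a blocked graph: a square of period 1 is an
  -- edge inside a block, and longer squares would need a path on four vertices.
  blocked-thue : Blocked Adj → IsThueColouring Adj 2 (blockColour ∘ toℕ)
  blocked-thue blocked (suc zero) _ v path sq with blocked _ _ (proj₁ (path-edge path fzero (fsuc fzero) refl))
  ... | inj₁ (up , r)   = blockColour-step (toℕ (v fzero)) r (trans (sq fzero) (cong blockColour (sym up)))
  ... | inj₂ (down , r) = blockColour-step (toℕ (v (fsuc fzero))) r (trans (sym (sq fzero)) (cong blockColour (sym down)))
  blocked-thue blocked (suc (suc m)) _ v path _ =
    blocked-no-path4 blocked (prefix-path (s≤s (s≤s (≤-trans (s≤s (s≤s z≤n)) (m≤n+m (suc (suc m)) m)))) path)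

thrice : ℕ → ℕ
thrice zero    = zero
thrice (suc a) = suc (suc (suc (thrice a)))

quot3 : ℕ → ℕ
quot3 zero                = 0
quot3 (suc zero)          = 0
quot3 (suc (suc zero))    = 0
quot3 (suc (suc (suc n))) = suc (quot3 n)

bit : ℕ → ℕ
bit zero          = 0
bit (suc zero)    = 1
bit (suc (suc n)) = bit n

quot3-rem3 : ∀ e → thrice (quot3 e) + rem3 e ≡ e
quot3-rem3 zero                = refl
quot3-rem3 (suc zero)          = refl
quot3-rem3 (suc (suc zero))    = refl
quot3-rem3 (suc (suc (suc e))) = cong (λ z → suc (suc (suc z))) (quot3-rem3 e)

half-bit : ∀ d → double ⌊ d /2⌋ + bit d ≡ d
half-bit zero          = refl
half-bit (suc zero)    = refl
half-bit (suc (suc d)) = cong (λ z → suc (suc z)) (half-bit d)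

rem3<3 : ∀ e → rem3 e < 3
rem3<3 zero                = s≤s z≤n
rem3<3 (suc zero)          = s≤s (s≤s z≤n)
rem3<3 (suc (suc zero))    = s≤s (s≤s (s≤s z≤n))
rem3<3 (suc (suc (suc e))) = rem3<3 e

bit<2 : ∀ d → bit d < 2
bit<2 zero          = s≤s z≤n
bit<2 (suc zero)    = s≤s (s≤s z≤n)
bit<2 (suc (suc d)) = bit<2 d

quot3≤ : ∀ e → quot3 e ≤ e
quot3≤ zero                = z≤n
quot3≤ (suc zero)          = z≤n
quot3≤ (suc (suc zero))    = z≤n
quot3≤ (suc (suc (suc e))) = s≤s (≤-trans (quot3≤ e) (≤-trans (n≤1+n e) (n≤1+n (suc e))))

rem3-thrice : ∀ a r → r < 3 → rem3 (thrice a + r) ≡ r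
rem3-thrice zero    zero             _ = refl
rem3-thrice zero    (suc zero)       _ = refl
rem3-thrice zero    (suc (suc zero)) _ = refl
rem3-thrice zero    (suc (suc (suc r))) (s≤s (s≤s (s≤s ())))
rem3-thrice (suc a) r r<3 = rem3-thrice a r r<3

quot3-thrice : ∀ a r → r < 3 → quot3 (thrice a + r) ≡ a
quot3-thrice zero    zero             _ = refl
quot3-thrice zero    (suc zero)       _ = refl
quot3-thrice zero    (suc (suc zero)) _ = refl
quot3-thrice zero    (suc (suc (suc r))) (s≤s (s≤s (s≤s ())))
quot3-thrice (suc a) r r<3 = cong suc (quot3-thrice a r r<3)

half-double : ∀ q r → r < 2 → ⌊ double q + r /2⌋ ≡ q
half-double zero    zero       _ = refl
half-double zero    (suc zero) _ = refl
half-double zero    (suc (suc r)) (s≤s (s≤s ()))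
half-double (suc q) r r<2 = cong suc (half-double q r r<2)

bit-double : ∀ q r → r < 2 → bit (double q + r) ≡ r
bit-double zero    zero       _ = refl
bit-double zero    (suc zero) _ = refl
bit-double zero    (suc (suc r)) (s≤s (s≤s ()))
bit-double (suc q) r r<2 = bit-double q r r<2

-- a < ⌊m/3⌋ exactly when the block {3a, 3a+1, 3a+2} and the vertex 3a+3 lie below m+1.
quot3-bound : ∀ m a → a < quot3 m → thrice (suc a) ≤ m
quot3-bound (suc (suc (suc m))) zero    _           = s≤s (s≤s (s≤s z≤n))
quot3-bound (suc (suc (suc m))) (suc a) (s≤s a<q)   = s≤s (s≤s (s≤s (quot3-bound m a a<q)))

quot3-bound⁻¹ : ∀ m a → thrice (suc a) ≤ m → a < quot3 m
quot3-bound⁻¹ (suc (suc (suc m))) zero    _                       = s≤s z≤n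
quot3-bound⁻¹ (suc (suc (suc m))) (suc a) (s≤s (s≤s (s≤s 3a≤m))) = s≤s (quot3-bound⁻¹ m a 3a≤m)
quot3-bound⁻¹ (suc zero)          zero    (s≤s ())
quot3-bound⁻¹ (suc (suc zero))    zero    (s≤s (s≤s ()))

-- Both comparisons below are the lexicographic comparison of (q, r) with (k, s).
double<⇒thrice< : ∀ q k r s → r < 2 → s < 3 → double q + r < double k + s → thrice q + r < thrice k + s
double<⇒thrice< zero    zero    r s _   _ lt = lt
double<⇒thrice< zero    (suc k) r s r<2 _ _  = ≤-trans r<2 (s≤s (s≤s z≤n))
double<⇒thrice< (suc q) zero    r s _ (s≤s (s≤s (s≤s ()))) (s≤s (s≤s (s≤s _)))
double<⇒thrice< (suc q) (suc k) r s r<2 s<3 (s≤s (s≤s lt)) = s≤s (s≤s (s≤s (double<⇒thrice< q k r s r<2 s<3 lt)))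

thrice<⇒double< : ∀ q k r s → r < 2 → s < 3 → thrice q + r < thrice k + s → double q + r < double k + s
thrice<⇒double< zero    zero    r s _   _ lt = lt
thrice<⇒double< zero    (suc k) r s r<2 _ _  = ≤-trans r<2 (s≤s (s≤s z≤n))
thrice<⇒double< (suc q) zero    r s _ (s≤s (s≤s (s≤s ()))) (s≤s (s≤s (s≤s (s≤s _))))
thrice<⇒double< (suc q) (suc k) r s r<2 s<3 (s≤s (s≤s (s≤s lt))) = s≤s (s≤s (thrice<⇒double< q k r s r<2 s<3 lt))

-- The d-th number that is ≢ 2 (mod 3).
keptEdge : ℕ → ℕ
keptEdge d = thrice ⌊ d /2⌋ + bit d

-- The deletion order with k cut edges: step j deletes the cut edge 3j+2 while j < k,
-- then the remaining edges in increasing order.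
order : ℕ → ℕ → ℕ
order k j with j <? k
... | yes _ = thrice j + 2
... | no _  = keptEdge (j ∸ k)

-- Its inverse: the step at which edge e is deleted.
slot : ℕ → ℕ → ℕ
slot k e with rem3 e ≟ 2
... | yes _ = quot3 e
... | no _  = k + (double (quot3 e) + rem3 e)

order-cut : ∀ k j → j < k → order k j ≡ thrice j + 2
order-cut k j j<k with j <? k
... | yes _   = refl
... | no j≮k = contradiction j<k j≮k

order-kept : ∀ k j → k ≤ j → order k j ≡ keptEdge (j ∸ k)
order-kept k j k≤j with j <? k
... | yes j<k = contradiction k≤j (<⇒≱ j<k)
... | no _    = refl

slot-cut : ∀ k e → rem3 e ≡ 2 → slot k e ≡ quot3 e
slot-cut k e r≡2 with rem3 e ≟ 2
... | yes _   = refl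
... | no r≢2 = contradiction r≡2 r≢2

slot-kept : ∀ k e → rem3 e ≢ 2 → slot k e ≡ k + (double (quot3 e) + rem3 e)
slot-kept k e r≢2 with rem3 e ≟ 2
... | yes r≡2 = contradiction r≡2 r≢2
... | no _    = refl

rem3<2 : ∀ e → rem3 e ≢ 2 → rem3 e < 2
rem3<2 e r≢2 with rem3 e | rem3<3 e
... | zero             | _ = s≤s z≤n
... | suc zero         | _ = s≤s (s≤s z≤n)
... | suc (suc zero)   | _ = contradiction refl r≢2
... | suc (suc (suc _)) | s≤s (s≤s (s≤s ()))

rem3-keptEdge : ∀ d → rem3 (keptEdge d) ≡ bit d
rem3-keptEdge d = rem3-thrice ⌊ d /2⌋ (bit d) (≤-trans (bit<2 d) (n≤1+n 2))

quot3-keptEdge : ∀ d → quot3 (keptEdge d) ≡ ⌊ d /2⌋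
quot3-keptEdge d = quot3-thrice ⌊ d /2⌋ (bit d) (≤-trans (bit<2 d) (n≤1+n 2))

keptEdge-kept : ∀ d → rem3 (keptEdge d) ≢ 2
keptEdge-kept d r≡2 = <⇒≢ (bit<2 d) (trans (sym (rem3-keptEdge d)) r≡2)

thrice≡ : ∀ k → thrice k ≡ k + double k
thrice≡ zero    = refl
thrice≡ (suc k) = cong suc (begin
  suc (suc (thrice k))          ≡⟨ cong (λ z → suc (suc z)) (thrice≡ k) ⟩
  suc (suc (k + double k))      ≡⟨ cong suc (sym (+-suc k (double k))) ⟩
  suc (k + suc (double k))      ≡⟨ sym (+-suc k (suc (double k))) ⟩
  k + suc (suc (double k))      ∎)
  where open ≡-Reasoning

module DeletionOrder (m : ℕ) where

  k : ℕ
  k = quot3 m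

  -- m = k + (2k + rem3 m): the steps from k on enumerate the 2k + rem3 m kept edges.
  m≡ : k + (double k + rem3 m) ≡ m
  m≡ = trans (sym (+-assoc k (double k) (rem3 m))) (trans (cong (_+ rem3 m) (sym (thrice≡ k))) (quot3-rem3 m))

  order-bound : ∀ j → j < m → order k j < m
  order-bound j j<m with j <? k
  ... | yes j<k = subst (_< m) (+-comm 2 (thrice j)) (quot3-bound m j j<k)
  ... | no j≮k = subst (keptEdge d <_) (quot3-rem3 m)
                   (double<⇒thrice< ⌊ d /2⌋ k (bit d) (rem3 m) (bit<2 d) (rem3<3 m) d<)
    where
      d = j ∸ k
      d< : double ⌊ d /2⌋ + bit d < double k + rem3 m
      d< = subst (_< double k + rem3 m) (sym (half-bit d))
             (+-cancelˡ-< k d _ (subst₂ _<_ (sym (m+[n∸m]≡n (≮⇒≥ j≮k))) (sym m≡) j<m))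

  slot-bound : ∀ e → e < m → slot k e < m
  slot-bound e e<m with rem3 e ≟ 2
  ... | yes _   = ≤-<-trans (quot3≤ e) e<m
  ... | no r≢2 = subst (slot′ <_) m≡ (+-monoʳ-< k
                   (thrice<⇒double< (quot3 e) k (rem3 e) (rem3 m) (rem3<2 e r≢2) (rem3<3 m)
                     (subst₂ _<_ (sym (quot3-rem3 e)) (sym (quot3-rem3 m)) e<m)))
    where slot′ = k + (double (quot3 e) + rem3 e)

  slot-order : ∀ j → slot k (order k j) ≡ j
  slot-order j with j <? k
  ... | yes _   = trans (slot-cut k (thrice j + 2) (rem3-thrice j 2 ≤-refl)) (quot3-thrice j 2 ≤-refl)
  ... | no j≮k = begin
    slot k (keptEdge d)
      ≡⟨ slot-kept k (keptEdge d) (keptEdge-kept d) ⟩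
    k + (double (quot3 (keptEdge d)) + rem3 (keptEdge d))
      ≡⟨ cong₂ (λ q r → k + (double q + r)) (quot3-keptEdge d) (rem3-keptEdge d) ⟩
    k + (double ⌊ d /2⌋ + bit d)
      ≡⟨ cong (k +_) (half-bit d) ⟩
    k + d
      ≡⟨ m+[n∸m]≡n (≮⇒≥ j≮k) ⟩
    j ∎
    where
      open ≡-Reasoning
      d = j ∸ k

  order-slot : ∀ e → e < m → order k (slot k e) ≡ e
  order-slot e e<m with rem3 e ≟ 2
  ... | yes r≡2 = begin
    order k (quot3 e)      ≡⟨ order-cut k (quot3 e) (quot3-bound⁻¹ m (quot3 e) (subst (_< m) e≡ e<m)) ⟩
    thrice (quot3 e) + 2   ≡⟨ cong (thrice (quot3 e) +_) (sym r≡2) ⟩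
    thrice (quot3 e) + rem3 e ≡⟨ quot3-rem3 e ⟩
    e                      ∎
    where
      open ≡-Reasoning
      e≡ : e ≡ suc (suc (thrice (quot3 e)))
      e≡ = trans (sym (quot3-rem3 e)) (trans (cong (thrice (quot3 e) +_) r≡2) (+-comm (thrice (quot3 e)) 2))
  ... | no r≢2 = begin
    order k (k + x)                ≡⟨ order-kept k (k + x) (m≤m+n k x) ⟩
    keptEdge (k + x ∸ k)           ≡⟨ cong keptEdge (m+n∸m≡n k x) ⟩
    thrice ⌊ x /2⌋ + bit x         ≡⟨ cong₂ (λ q r → thrice q + r) (half-double (quot3 e) (rem3 e) r<2)
                                                                  (bit-double (quot3 e) (rem3 e) r<2) ⟩
    thrice (quot3 e) + rem3 e      ≡⟨ quot3-rem3 e ⟩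
    e                              ∎
    where
      open ≡-Reasoning
      x = double (quot3 e) + rem3 e
      r<2 = rem3<2 e r≢2

  orderFin slotFin : Fin m → Fin m
  orderFin j = fromℕ< (order-bound (toℕ j) (toℕ<n j))
  slotFin e  = fromℕ< (slot-bound (toℕ e) (toℕ<n e))

  toℕ-orderFin : ∀ j → toℕ (orderFin j) ≡ order k (toℕ j)
  toℕ-orderFin j = toℕ-fromℕ< (order-bound (toℕ j) (toℕ<n j))

  toℕ-slotFin : ∀ e → toℕ (slotFin e) ≡ slot k (toℕ e)
  toℕ-slotFin e = toℕ-fromℕ< (slot-bound (toℕ e) (toℕ<n e))

  σ : Permutation′ m
  σ = permutation orderFin slotFin
    (λ e → toℕ-injective (trans (toℕ-orderFin (slotFin e))
                           (trans (cong (order k) (toℕ-slotFin e)) (order-slot (toℕ e) (toℕ<n e)))))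
    (λ j → toℕ-injective (trans (toℕ-slotFin (orderFin j))
                           (trans (cong (slot k) (toℕ-orderFin j)) (slot-order (toℕ j)))))

  σ-kept : ∀ j → k ≤ toℕ j → rem3 (toℕ (σ ⟨$⟩ʳ j)) ≢ 2
  σ-kept j k≤j = subst (λ e → rem3 e ≢ 2) (sym (trans (toℕ-orderFin j) (order-kept k (toℕ j) k≤j)))
                   (keptEdge-kept (toℕ j ∸ k))

sum-mono : ∀ N (f g : Fin N → ℕ) → (∀ i → f i ≤ g i) → sum (tabulate f) ≤ sum (tabulate g)
sum-mono zero    f g f≤g = z≤n
sum-mono (suc N) f g f≤g = +-mono-≤ (f≤g fzero) (sum-mono N (f ∘ fsuc) (g ∘ fsuc) (f≤g ∘ fsuc))

Σ< : ℕ → (ℕ → ℕ) → ℕ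
Σ< N f = sum (tabulate {n = N} (f ∘ toℕ))

Σ<-+ : ∀ N f g → Σ< N (λ x → f x + g x) ≡ Σ< N f + Σ< N g
Σ<-+ zero    f g = refl
Σ<-+ (suc N) f g = trans (cong (f 0 + g 0 +_) (Σ<-+ N (f ∘ suc) (g ∘ suc)))
                         (+-exchange (f 0) (g 0) (Σ< N (f ∘ suc)) (Σ< N (g ∘ suc)))
  where
    +-exchange : ∀ a b c d → a + b + (c + d) ≡ a + c + (b + d)
    +-exchange = solve-∀

below : ℕ → ℕ → ℕ
below x       zero    = 0
below zero    (suc c) = 1
below (suc x) (suc c) = below x c

below-yes : ∀ {x c} → x < c → below x c ≡ 1
below-yes {zero}  {suc c} _ = refl
below-yes {suc x} {suc c} (s≤s x<c) = below-yes x<c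

below-no : ∀ {x c} → c ≤ x → below x c ≡ 0
below-no {x}     {zero}  _ = refl
below-no {suc x} {suc c} (s≤s c≤x) = below-no c≤x

Σ<-below : ∀ N c → c ≤ N → Σ< N (λ x → below x c) ≡ c
Σ<-below N       zero    _         = Σ<-zero N
  where
    Σ<-zero : ∀ N → Σ< N (λ x → below x 0) ≡ 0
    Σ<-zero zero    = refl
    Σ<-zero (suc N) = Σ<-zero N
Σ<-below (suc N) (suc c) (s≤s c≤N) = cong suc (Σ<-below N c c≤N)

Σ<-one : ∀ N → Σ< N (λ _ → 1) ≡ N
Σ<-one zero    = refl
Σ<-one (suc N) = cong suc (Σ<-one N)

module PathDeletion (m : ℕ) where

  open DeletionOrder m using (k; σ; σ-kept)

  G* : Permutation′ m → ℕ → Rel (suc m)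
  G* τ i = GStar (P (suc m)) τ i

  Spans : ℕ → Fin (suc m) → Fin (suc m) → Set
  Spans e u v = (toℕ u ≡ e × toℕ v ≡ suc e) ⊎ (toℕ v ≡ e × toℕ u ≡ suc e)

  G*-edge : ∀ τ i {u v} → G* τ i u v → ∃[ j ] (i ≤ toℕ j × Spans (toℕ (τ ⟨$⟩ʳ j)) u v)
  G*-edge τ i (j , i≤j , inj₁ (refl , refl)) = j , i≤j , inj₁ (toℕ-inject₁ _ , refl)
  G*-edge τ i (j , i≤j , inj₂ (refl , refl)) = j , i≤j , inj₂ (toℕ-inject₁ _ , refl)

  G*-edge⁻¹ : ∀ τ i (e : Fin m) → i ≤ toℕ (τ ⟨$⟩ˡ e) → G* τ i (inject₁ e) (fsuc e)
  G*-edge⁻¹ τ i e i≤j = τ ⟨$⟩ˡ e , i≤j , inj₁ (cong inject₁ (inverseʳ τ) , cong fsuc (inverseʳ τ))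

  G*-consecutive : ∀ τ i → Consecutive (G* τ i)
  G*-consecutive τ i u v uv with G*-edge τ i uv
  ... | _ , _ , inj₁ (u≡e , v≡1+e) = inj₁ (trans (cong suc u≡e) (sym v≡1+e))
  ... | _ , _ , inj₂ (v≡e , u≡1+e) = inj₂ (trans (cong suc v≡e) (sym u≡1+e))

  G*σ-blocked : ∀ i → k ≤ i → Blocked (G* σ i)
  G*σ-blocked i k≤i u v uv with G*-edge σ i uv
  ... | j , i≤j , inj₁ (u≡e , v≡1+e) =
    inj₁ (trans (cong suc u≡e) (sym v≡1+e) , subst (λ z → rem3 z ≢ 2) (sym u≡e) (σ-kept j (≤-trans k≤i i≤j)))
  ... | j , i≤j , inj₂ (v≡e , u≡1+e) =
    inj₂ (trans (cong suc v≡e) (sym u≡1+e) , subst (λ z → rem3 z ≢ 2) (sym v≡e) (σ-kept j (≤-trans k≤i i≤j)))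

  G*-edgeless : ∀ τ i → m ≤ i → ∀ u v → ¬ G* τ i u v
  G*-edgeless τ i m≤i u v (j , i≤j , _) = <⇒≱ (toℕ<n j) (≤-trans m≤i i≤j)

  G*-has-edge : ∀ τ i → i < m → ∃[ u ] ∃[ v ] (G* τ i u v × u ≢ v)
  G*-has-edge τ i i<m =
    inject₁ e , fsuc e , (j , ≤-reflexive (sym (toℕ-fromℕ< i<m)) , inj₁ (refl , refl)) ,
    λ e≡1+e → 1+n≢n (sym (trans (sym (toℕ-inject₁ e)) (cong toℕ e≡1+e)))
    where
      j = fromℕ< i<m
      e = τ ⟨$⟩ʳ j

  block-bound : ∀ (a : Fin k) r → r ≤ 3 → thrice (toℕ a) + r ≤ m
  block-bound a r r≤3 = ≤-trans (+-monoʳ-≤ (thrice (toℕ a)) r≤3)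
    (subst (_≤ m) (+-comm 3 (thrice (toℕ a))) (quot3-bound m (toℕ a) (toℕ<n a)))

  edge-bound : ∀ a (r : Fin 3) → thrice (toℕ a) + toℕ r < m
  edge-bound a r = subst (_≤ m) (+-suc (thrice (toℕ a)) (toℕ r)) (block-bound a (suc (toℕ r)) (toℕ<n r))

  vertex-bound : ∀ a (r : Fin 4) → thrice (toℕ a) + toℕ r < suc m
  vertex-bound a r = s≤s (block-bound a (toℕ r) (≤-pred (toℕ<n r)))

  blockEdge : Fin k → Fin 3 → Fin m
  blockEdge a r = fromℕ< (edge-bound a r)

  blockVertex : Fin k → Fin 4 → Fin (suc m)
  blockVertex a r = fromℕ< (vertex-bound a r)

  toℕ-blockEdge : ∀ a r → toℕ (blockEdge a r) ≡ thrice (toℕ a) + toℕ r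
  toℕ-blockEdge a r = toℕ-fromℕ< (edge-bound a r)

  toℕ-blockVertex : ∀ a r → toℕ (blockVertex a r) ≡ thrice (toℕ a) + toℕ r
  toℕ-blockVertex a r = toℕ-fromℕ< (vertex-bound a r)

  Intact : Permutation′ m → ℕ → Fin k → Set
  Intact τ i a = ∀ r → i ≤ toℕ (τ ⟨$⟩ˡ blockEdge a r)

  block-path : ∀ τ i a → Intact τ i a → IsPath (G* τ i) 4 (blockVertex a)
  block-path τ i a survives = injective , adjacent
    where
      A = thrice (toℕ a)
      injective : Injective _≡_ _≡_ (blockVertex a)
      injective {r} {r′} e = toℕ-injective (+-cancelˡ-≡ A (toℕ r) (toℕ r′)
        (trans (sym (toℕ-blockVertex a r)) (trans (cong toℕ e) (toℕ-blockVertex a r′))))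
      adjacent : ∀ r r′ → toℕ r′ ≡ suc (toℕ r) → G* τ i (blockVertex a r) (blockVertex a r′)
      adjacent r r′ r′≡1+r = subst₂ (G* τ i) lower upper (G*-edge⁻¹ τ i E (survives ρ))
        where
          r<3 : toℕ r < 3
          r<3 = ≤-pred (subst (_< 4) r′≡1+r (toℕ<n r′))
          ρ = fromℕ< r<3
          E = blockEdge a ρ
          toℕE : toℕ E ≡ A + toℕ r
          toℕE = trans (toℕ-blockEdge a ρ) (cong (A +_) (toℕ-fromℕ< r<3))
          lower : inject₁ E ≡ blockVertex a r
          lower = toℕ-injective (trans (toℕ-inject₁ E) (trans toℕE (sym (toℕ-blockVertex a r))))
          upper : fsuc E ≡ blockVertex a r′
          upper = toℕ-injective (trans (cong suc toℕE)
                    (trans (sym (+-suc A (toℕ r))) (trans (cong (A +_) (sym r′≡1+r)) (sym (toℕ-blockVertex a r′)))))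

  same-step-same-block : ∀ (τ : Permutation′ m) a₁ a₂ r₁ r₂ →
    τ ⟨$⟩ˡ blockEdge a₁ r₁ ≡ τ ⟨$⟩ˡ blockEdge a₂ r₂ → toℕ a₁ ≡ toℕ a₂
  same-step-same-block τ a₁ a₂ r₁ r₂ same-step = begin
    toℕ a₁                                 ≡⟨ sym (quot3-thrice (toℕ a₁) (toℕ r₁) (toℕ<n r₁)) ⟩
    quot3 (thrice (toℕ a₁) + toℕ r₁)       ≡⟨ cong quot3 same-edge ⟩
    quot3 (thrice (toℕ a₂) + toℕ r₂)       ≡⟨ quot3-thrice (toℕ a₂) (toℕ r₂) (toℕ<n r₂) ⟩
    toℕ a₂                                 ∎
    where
      open ≡-Reasoning
      same-edge : thrice (toℕ a₁) + toℕ r₁ ≡ thrice (toℕ a₂) + toℕ r₂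
      same-edge = trans (sym (toℕ-blockEdge a₁ r₁))
        (trans (cong toℕ (trans (sym (inverseʳ τ)) (trans (cong (τ ⟨$⟩ʳ_) same-step) (inverseʳ τ))))
               (toℕ-blockEdge a₂ r₂))

  -- Fewer than k deletions leave some block intact: otherwise choosing, for every block,
  -- a step deleting one of its edges would map the k blocks injectively into i < k steps.
  surviving-block : ∀ τ i → i < k → ∃[ a ] Intact τ i a
  surviving-block τ i i<k with any? {P = Intact τ i} (λ a → all? (λ r → i ≤? toℕ (τ ⟨$⟩ˡ blockEdge a r)))
  ... | yes intact     = intact
  ... | no none-intact = ⊥-elim (injective-step (pigeonhole i<k step))
    where
      hit : ∀ a → ∃[ r ] toℕ (τ ⟨$⟩ˡ blockEdge a r) < i
      hit a with ¬∀⟶∃¬ 3 (λ r → i ≤ toℕ (τ ⟨$⟩ˡ blockEdge a r))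
                          (λ r → i ≤? toℕ (τ ⟨$⟩ˡ blockEdge a r)) (λ all → none-intact (a , all))
      ... | r , deleted = r , ≰⇒> deleted
      step : Fin k → Fin i
      step a = fromℕ< (proj₂ (hit a))
      injective-step : ¬ (∃[ a₁ ] ∃[ a₂ ] (toℕ a₁ < toℕ a₂ × step a₁ ≡ step a₂))
      injective-step (a₁ , a₂ , a₁<a₂ , same) = <⇒≢ a₁<a₂
        (same-step-same-block τ a₁ a₂ (proj₁ (hit a₁)) (proj₁ (hit a₂))
          (toℕ-injective (trans (sym (toℕ-fromℕ< (proj₂ (hit a₁))))
                                (trans (cong toℕ same) (toℕ-fromℕ< (proj₂ (hit a₂)))))))

  G*-path4 : ∀ τ i → i < k → ∃[ w ] IsPath (G* τ i) 4 w
  G*-path4 τ i i<k with surviving-block τ i i<k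
  ... | a , survives = blockVertex a , block-path τ i a survives

  -- The optimal profile of Thue numbers: 3 while a block is intact, 2 while an edge
  -- remains, then 1.
  profile : ℕ → ℕ
  profile i = suc (below i m + below i k)

  data Regime (i : ℕ) : Set where
    intact-block : i < k → profile i ≡ 3 → Regime i
    some-edge    : k ≤ i → i < m → profile i ≡ 2 → Regime i
    no-edge      : m ≤ i → profile i ≡ 1 → Regime i

  regime : ∀ i → Regime i
  regime i with i <? k | i <? m
  ... | yes i<k | _       =
    intact-block i<k (cong suc (cong₂ _+_ (below-yes (<-≤-trans i<k (quot3≤ m))) (below-yes i<k)))
  ... | no i≮k  | yes i<m =
    some-edge (≮⇒≥ i≮k) i<m (cong suc (cong₂ _+_ (below-yes i<m) (below-no (≮⇒≥ i≮k))))
  ... | no i≮k  | no i≮m  =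
    no-edge (≮⇒≥ i≮m) (cong suc (cong₂ _+_ (below-no (≮⇒≥ i≮m)) (below-no (≮⇒≥ i≮k))))

  profile-lower : ∀ τ i j ψ → IsThueColouring (G* τ i) j ψ → profile i ≤ j
  profile-lower τ i j ψ thue with regime i
  ... | intact-block i<k p≡3 =
    subst (_≤ j) (sym p≡3) (path4⇒3≤ (G* τ i) {ψ = ψ} (proj₂ (G*-path4 τ i i<k)) thue)
  ... | some-edge _ i<m p≡2 with G*-has-edge τ i i<m
  ...   | _ , _ , uv , u≢v = subst (_≤ j) (sym p≡2) (edge⇒2≤ (G* τ i) {ψ = ψ} uv u≢v thue)
  profile-lower τ i j ψ thue | no-edge _ p≡1 = subst (_≤ j) (sym p≡1) (colours-nonempty j ψ)

  Colourable : Permutation′ m → ℕ → ℕ → Set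
  Colourable τ i c = Σ (Fin (suc m) → Fin c) (IsThueColouring (G* τ i) c)

  profile-colouring : ∀ i → Colourable σ i (profile i)
  profile-colouring i with regime i
  ... | intact-block _ p≡3 = subst (Colourable σ i) (sym p≡3)
          (ternaryTM ∘ toℕ , consecutive-thue (G* σ i) (G*-consecutive σ i))
  ... | some-edge k≤i _ p≡2 = subst (Colourable σ i) (sym p≡2)
          (blockColour ∘ toℕ , blocked-thue (G* σ i) (G*σ-blocked i k≤i))
  ... | no-edge m≤i p≡1 = subst (Colourable σ i) (sym p≡1)
          ((λ _ → fzero) , edgeless-thue (G* σ i) (G*-edgeless σ i m≤i))

  σ-thue-number : ∀ i → HasThueNumber (G* σ i) (profile i)
  σ-thue-number i = profile-colouring i , λ j ψ → profile-lower σ i j ψ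

  profile-sum : Σ< (suc m) profile ≡ suc m + m + k
  profile-sum = begin
    S profile                        ≡⟨ Σ<-+ (suc m) (λ _ → 1) (λ x → below x m + below x k) ⟩
    S (λ _ → 1) + S (λ x → below x m + below x k)
                                     ≡⟨ cong₂ _+_ (Σ<-one (suc m)) (Σ<-+ (suc m) (λ x → below x m) (λ x → below x k)) ⟩
    suc m + (S (λ x → below x m) + S (λ x → below x k))
                                     ≡⟨ cong (suc m +_) (cong₂ _+_ (Σ<-below (suc m) m (n≤1+n m))
                                                                   (Σ<-below (suc m) k (≤-trans (quot3≤ m) (n≤1+n m)))) ⟩
    suc m + (m + k)                  ≡⟨ sym (+-assoc (suc m) m k) ⟩
    suc m + m + k                    ∎
    where
      open ≡-Reasoning
      S = Σ< (suc m)

frac-cong : ∀ a b d e → a * suc e ≡ b * suc d → frac a (suc d) ≡ frac b (suc e)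
frac-cong a b d e eq = ℚ.fromℚᵘ-cong {ℚᵘ.mkℚᵘ (ℤ.+ a) d} {ℚᵘ.mkℚᵘ (ℤ.+ b) e}
  (ℚᵘ.*≡* (trans (sym (ℤ.pos-* a (suc e))) (trans (cong ℤ.+_ eq) (ℤ.pos-* b (suc d)))))

frac-mono : ∀ a b d → a ≤ b → frac a (suc d) ≤ℚ frac b (suc d)
frac-mono a b d a≤b = ℚ.toℚᵘ-cancel-≤
  (ℚᵘ.≤-respʳ-≃ (ℚᵘ.≃-sym (ℚ.toℚᵘ-fromℚᵘ (ℚᵘ.mkℚᵘ (ℤ.+ b) d)))
    (ℚᵘ.≤-respˡ-≃ (ℚᵘ.≃-sym (ℚ.toℚᵘ-fromℚᵘ (ℚᵘ.mkℚᵘ (ℤ.+ a) d)))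
      (ℚᵘ.*≤* (subst₂ ℤ._≤_ (ℤ.pos-* a (suc d)) (ℤ.pos-* b (suc d)) (ℤ.+≤+ (*-monoˡ-≤ (suc d) a≤b))))))

tau-path : ∀ m → IsTauIndex (P (suc m)) (frac (suc m + m + quot3 m) (suc m))
tau-path m = (σ , profile ∘ toℕ , σ-thue-number ∘ toℕ , cong (λ z → frac z (suc m)) profile-sum)
           , λ τ p valid → subst (_≤ℚ TauValue (P (suc m)) τ p) (cong (λ z → frac z (suc m)) profile-sum)
               (frac-mono _ _ m (sum-mono (suc m) (profile ∘ toℕ) p λ i →
                  profile-lower τ (toℕ i) (p i) (proj₁ (proj₁ (valid i))) (proj₂ (proj₁ (valid i)))))
  where
    open DeletionOrder m using (σ)
    open PathDeletion m

thrice≡3* : ∀ t → thrice t ≡ 3 * t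
thrice≡3* zero    = refl
thrice≡3* (suc t) = trans (cong (3 +_) (thrice≡3* t)) (sym (*-suc 3 t))

residue : ∀ m j r → j + r ≡ 2 → ∀ t → suc m + j ≡ 3 * t → ∃[ t′ ] m ≡ 3 * t′ + r
residue m j r j+r≡2 (suc t) n+j≡3t = t , +-cancelʳ-≡ j m (3 * t + r) (suc-injective (begin
  suc (m + j)            ≡⟨ n+j≡3t ⟩
  3 * suc t              ≡⟨ three-blocks t ⟩
  suc (3 * t + 2)        ≡⟨ cong (λ z → suc (3 * t + z)) (sym j+r≡2) ⟩
  suc (3 * t + (j + r))  ≡⟨ cong suc (regroup t j r) ⟩
  suc (3 * t + r + j)    ∎))
  where
    open ≡-Reasoning
    three-blocks : ∀ t → 3 * suc t ≡ suc (3 * t + 2)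
    three-blocks = solve-∀
    regroup : ∀ t j r → 3 * t + (j + r) ≡ 3 * t + r + j
    regroup = solve-∀

closed-form : ∀ t r → frac (suc (3 * t + r) + (3 * t + r) + t) (suc (3 * t + r)) ≡
                      frac (7 * suc (3 * t + r) ∸ (4 + r)) (3 * suc (3 * t + r))
closed-form t r = begin
  frac (suc m + m + t) (suc m)                     ≡⟨ frac-cong (suc m + m + t) c m (m + 2 * suc m) (cross t r) ⟩
  frac c (3 * suc m)                               ≡⟨ cong (λ a → frac a (3 * suc m)) (sym (m+n∸n≡m c (4 + r))) ⟩
  frac (c + (4 + r) ∸ (4 + r)) (3 * suc m)         ≡⟨ cong (λ a → frac (a ∸ (4 + r)) (3 * suc m)) (sym (seven t r)) ⟩
  frac (7 * suc m ∸ (4 + r)) (3 * suc m)           ∎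
  where
    open ≡-Reasoning
    m = 3 * t + r
    c = 21 * t + 6 * r + 3
    cross : ∀ t r → (suc (3 * t + r) + (3 * t + r) + t) * (3 * suc (3 * t + r)) ≡
                    (21 * t + 6 * r + 3) * suc (3 * t + r)
    cross = solve-∀
    seven : ∀ t r → 7 * suc (3 * t + r) ≡ 21 * t + 6 * r + 3 + (4 + r)
    seven = solve-∀

tau-path-closed : ∀ m r → r ≤ 2 → ∃[ t ] m ≡ 3 * t + r →
  IsTauIndex (P (suc m)) (frac (7 * suc m ∸ (4 + r)) (3 * suc m))
tau-path-closed m r r≤2 (t , refl) =
  subst (IsTauIndex (P (suc m))) (trans (cong (λ q → frac (suc m + m + q) (suc m)) quot3≡t) (closed-form t r))
        (tau-path m)
  where
    quot3≡t : quot3 (3 * t + r) ≡ t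
    quot3≡t = trans (cong (λ z → quot3 (z + r)) (sym (thrice≡3* t))) (quot3-thrice t r (s≤s r≤2))

-- Proposition 2.5.  The three divisibility conditions on n = m + 1 say m ≡ 2, 1, 0 (mod 3);
-- the hypothesis n ≥ 4 only excludes n = 0, the formula holding for every n ≥ 1.
proposition2p5 : (n : ℕ) → 4 ≤ n →
    ((∃[ t ] n ≡ 3 * t) → IsTauIndex (P n) (frac (7 * n ∸ 6) (3 * n)))
    × ((∃[ t ] n + 1 ≡ 3 * t) → IsTauIndex (P n) (frac (7 * n ∸ 5) (3 * n)))
    × ((∃[ t ] n + 2 ≡ 3 * t) → IsTauIndex (P n) (frac (7 * n ∸ 4) (3 * n)))
proposition2p5 (suc m) _ =
    (λ (t , n≡3t)   → tau-path-closed m 2 ≤-refl    (residue m 0 2 refl t (trans (+-identityʳ (suc m)) n≡3t)))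
  , (λ (t , n+1≡3t) → tau-path-closed m 1 (s≤s z≤n) (residue m 1 1 refl t n+1≡3t))
  , (λ (t , n+2≡3t) → tau-path-closed m 0 z≤n       (residue m 2 0 refl t n+2≡3t))
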